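{- For every $n\ge1$, the map $\Theta:\mathrm{LDyck}_n\to\mathrm{SPCT}((2^n))$ is well defined and is a bijection, with inverse $\Phi:\mathrm{SPCT}((2^n))\to\mathrm{LDyck}_n$.
   Context: A Dyck path of semi-length $n$ is a lattice path from $(0,0)$ to $(2n,0)$ with steps $(1,1)$ (up-steps) and $(1,-1)$ (down-steps) never going below the $x$-axis. A labeled Dyck path of semi-length $n$ is a Dyck path of semi-length $n$ whose $n$ down-steps carry distinct labels from $[n]$; $\mathrm{LDyck}_n$ is the set of these. Given $D\in\mathrm{LDyck}_n$, label its up-steps as follows: for $i=n,n-1,\dots,1$, let $\mathfrak{D}_i$ be the set of labels of down-steps occurring after the $i$-th up-step and $\mathfrak{U}_i$ the set of labels already assigned to up-steps occurring after the $i$-th up-step; give the $i$-th up-step the label $\min(\mathfrak{D}_i\setminus\mathfrak{U}_i)$. Then every label in $[n]$ occurs on exactly one up-step and one down-step. $\mathrm{SPCT}((2^n))$ is the set of fillings $\tau$ of the $n\times 2$ array ($n$ rows, each of length $2$) with the distinct integers $1,\dots,2n$ such that each row decreases from left to right and (triple condition) whenever $i<r$ and the entries in cells $(i,1),(i,2),(r,2)$ are $a,b,c$, $a\ge c$ implies $b>c$. (No condition on the first column other than distinctness.) $\Theta(D)$: for $1\le i\le n$, if the up-step labeled $i$ is the $p$-th step of $D$ and the down-step labeled $i$ is the $q$-th step, then row $i$ of $\Theta(D)$ has $q$ in column $1$ and $p$ in column $2$. $\Phi(\tau)$: for $1\le i\le 2n$, the $i$-th step is an up-step if $i$ is in the second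 column of $\tau$, and otherwise a down-step labeled by the index of the row of $\tau$ containing $i$. -}

module Defs where

open import Data.Nat using (ℕ; zero; suc; _+_; _*_; _≤_; _<_; _≥_; _>_)
open import Data.Bool using (Bool; true; false; if_then_else_; _∧_; not)
open import Data.Fin as Fin using (Fin)
open import Data.Fin.Properties using () renaming (_≟_ to _≟F_)
open import Data.Maybe using (Maybe; just; nothing; maybe)
open import Data.List using (List; []; _∷_; length; map; upTo; allFin)
open import Data.List.Relation.Unary.Unique.Propositional using (Unique)
open import Data.List.Relation.Binary.Permutation.Propositional using (_↭_)
open import Data.Product using (_×_; _,_)
open import Data.Empty using (⊥)
open import Relation.Nullary using (does)
open import Relation.Binary.PropositionalEquality using (_≡_)
import Data.Nat as ℕ

-- Steps of a (labeled) Dyck path of semi-length n: an up-step, or a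
-- down-step carrying a label in Fin n  (Fin n ≅ [n], label i+1 ↦ i).

data Step (n : ℕ) : Set where
  up   : Step n
  down : Fin n → Step n

DyckFrom : {n : ℕ} → ℕ → List (Step n) → Set
DyckFrom h [] = h ≡ 0
DyckFrom h (up ∷ s) = DyckFrom (suc h) s
DyckFrom zero (down _ ∷ s) = ⊥
DyckFrom (suc h) (down _ ∷ s) = DyckFrom h s

downLabels : {n : ℕ} → List (Step n) → List (Fin n)
downLabels [] = []
downLabels (up ∷ s) = downLabels s
downLabels (down j ∷ s) = j ∷ downLabels s

IsLDyck : (n : ℕ) → List (Step n) → Set
IsLDyck n D = (length D ≡ 2 * n) × DyckFrom 0 D × Unique (downLabels D)

-- fully labelled steps; an up-step label is "Maybe" since min of an
-- empty set is undefined (this never happens for Dyck paths).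
data LStep (n : ℕ) : Set where
  U : Maybe (Fin n) → LStep n
  D : Fin n → LStep n

first : {A : Set} → (A → Bool) → List A → Maybe A
first p [] = nothing
first p (x ∷ xs) = if p x then just x else first p xs

_∈ᵇ_ : {n : ℕ} → Fin n → List (Fin n) → Bool
x ∈ᵇ [] = false
x ∈ᵇ (y ∷ ys) = if does (x ≟F y) then true else x ∈ᵇ ys

minDiff : {n : ℕ} → List (Fin n) → List (Fin n) → Maybe (Fin n)
minDiff {n} Ds Us = first (λ x → (x ∈ᵇ Ds) ∧ not (x ∈ᵇ Us)) (allFin n)

-- processes the path from the end; returns the labelled path together with
-- the labels of the down-steps occurring in it (𝔇) and the labels already
-- assigned to its up-steps (𝔘).
labelGo : {n : ℕ} → List (Step n) → List (LStep n) × List (Fin n) × List (Fin n)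
labelGo [] = [] , [] , []
labelGo (down j ∷ s) with labelGo s
... | ls , ds , us = D j ∷ ls , j ∷ ds , us
labelGo (up ∷ s) with labelGo s
... | ls , ds , us = U (minDiff ds us) ∷ ls , ds , maybe (_∷ us) us (minDiff ds us)

labelUps : {n : ℕ} → List (Step n) → List (LStep n)
labelUps s with labelGo s
... | ls , _ , _ = ls

upLabelList : {n : ℕ} → List (LStep n) → List (Maybe (Fin n))
upLabelList [] = []
upLabelList (U m ∷ s) = m ∷ upLabelList s
upLabelList (D _ ∷ s) = upLabelList s

-- Tableaux of shape (2^n): n rows, 2 columns, entries natural numbers.
-- Column Fin.zero is column 1, column Fin.suc Fin.zero is column 2.

Tableau : ℕ → Set
Tableau n = Fin n → Fin 2 → ℕ

col1 col2 : Fin 2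
col1 = Fin.zero
col2 = Fin.suc Fin.zero

IsSPCT : (n : ℕ) → Tableau n → Set
IsSPCT n τ =
  (∀ i c → 1 ≤ τ i c × τ i c ≤ 2 * n) ×
  (∀ i j c d → τ i c ≡ τ j d → (i ≡ j × c ≡ d)) ×
  (∀ i → τ i col1 > τ i col2) ×
  (∀ i r → i Fin.< r → τ i col1 ≥ τ r col2 → τ i col2 > τ r col2)

-- Θ and Φ.  Positions of steps are 1-based; 0 means "not found".

posFrom : {A : Set} → ℕ → (A → Bool) → List A → ℕ
posFrom k p [] = 0
posFrom k p (x ∷ xs) = if p x then k else posFrom (suc k) p xs

isDownL : {n : ℕ} → Fin n → LStep n → Bool
isDownL i (D j) = does (i ≟F j)
isDownL i (U _) = false

isUpL : {n : ℕ} → Fin n → LStep n → Bool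
isUpL i (U (just j)) = does (i ≟F j)
isUpL i (U nothing) = false
isUpL i (D _) = false

Θ : (n : ℕ) → List (Step n) → Tableau n
Θ n Dp i Fin.zero = posFrom 1 (isDownL i) (labelUps Dp)
Θ n Dp i (Fin.suc _) = posFrom 1 (isUpL i) (labelUps Dp)

stepAt : (n : ℕ) → Tableau n → ℕ → Step n
stepAt n τ k with first (λ r → does (τ r col2 ℕ.≟ k)) (allFin n)
... | just _ = up
... | nothing with first (λ r → does (τ r col1 ℕ.≟ k)) (allFin n)
...   | just r = down r
...   | nothing = up

Φ : (n : ℕ) → Tableau n → List (Step n)
Φ n τ = map (stepAt n τ) (map suc (upTo (2 * n)))

-- Both directions read the path from its end, one position k = 2n, …, 1 at a time.
-- For an SPCT τ, the suffix of Φ τ from position k has as down-labels the rows whose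
-- first entry is ≥ k, as up-labels the rows whose second entry is ≥ k, and as height the
-- number of rows with exactly one entry ≥ k. If k is the second entry of row r, the labels
-- available at k are the rows with first entry > k > second entry, and the triple condition
-- says exactly that none of them is smaller than r; so the up-step at k is labelled r and
-- Θ recovers τ; by pigeonhole every position 1, …, 2n is an entry of τ.
-- Conversely, for a labelled Dyck path the tableau Θ of each suffix stays injective,
-- row-decreasing and triple-closed: the available labels are counted by the height, so an
-- up-step always finds one, and since it takes the least one, every available label below
-- an assigned label r had its down-step before the up-step of r.

module Submission where

open import Defs
open import Data.Nat using (ℕ; _≤_)
open import Data.Fin using (Fin)
open import Data.Maybe using (just)
open import Data.List using (map; allFin)
open import Data.List.Relation.Binary.Permutation.Propositional using (_↭_)
open import Data.Product using (_×_)
open import Relation.Binary.PropositionalEquality using (_≡_)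

open import Data.Nat as ℕ using (zero; suc; _+_; _*_; _<_; _≤?_; z≤n; s≤s)
import Data.Nat.Properties as ℕₚ
open import Data.Fin as Fin using (zero; suc)
import Data.Fin.Properties as Finₚ
open import Data.Fin.Properties using () renaming (_≟_ to _≟F_)
open import Data.Bool using (Bool; true; false; if_then_else_; _∧_; not)
open import Data.Maybe as Maybe using (nothing; maybe)
open import Data.List using (List; []; _∷_; length; upTo; applyUpTo)
import Data.List.Properties as Listₚ
open import Data.List.Relation.Unary.All using (All; []; _∷_)
open import Data.List.Relation.Unary.AllPairs using ([]; _∷_)
open import Data.List.Relation.Unary.Any using (here; there)
open import Data.List.Membership.Propositional using (_∈_)
open import Data.List.Membership.Propositional.Properties using (∈-allFin)
open import Data.List.Membership.Propositional.Properties.WithK using (unique∧set⇒bag)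
open import Data.List.Relation.Binary.BagAndSetEquality using (∼bag⇒↭)
open import Data.List.Relation.Unary.Unique.Propositional using (Unique)
open import Data.List.Relation.Unary.Unique.Propositional.Properties using (allFin⁺)
open import Data.List.Relation.Binary.Permutation.Propositional.Properties using (map⁺)
open import Data.Product using (∃; _,_; proj₁; proj₂; uncurry)
open import Data.Sum using (_⊎_; inj₁; inj₂)
open import Data.Empty using (⊥; ⊥-elim)
open import Function.Bundles using (mk⇔)
open import Relation.Nullary using (¬_; Dec; yes; no; does)
open import Relation.Nullary.Decidable using (dec-true; dec-false; does-⇔; _×-dec_)
open import Relation.Binary.PropositionalEquality
  using (_≢_; refl; sym; trans; cong; cong₂; subst; module ≡-Reasoning)

≤?-suc : ∀ {k v} → v ≢ k → does (k ≤? v) ≡ does (suc k ≤? v)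
≤?-suc {k} {v} v≢k =
  does-⇔ (mk⇔ (λ k≤v → ℕₚ.≤∧≢⇒< k≤v (λ k≡v → v≢k (sym k≡v))) ℕₚ.<⇒≤) (k ≤? v) (suc k ≤? v)

does-true⇒ : ∀ {P : Set} (P? : Dec P) → does P? ≡ true → P
does-true⇒ (yes p) _ = p
does-true⇒ (no _) ()

true≢false : true ≢ false
true≢false ()

∧-not-true : ∀ a b → (a ∧ not b) ≡ true → a ≡ true × b ≡ false
∧-not-true true false refl = refl , refl

∧-not-false : ∀ {b} → (true ∧ not b) ≡ false → b ≡ true
∧-not-false {true} _ = refl

∧-false : ∀ {a} → (a ∧ false) ≢ true
∧-false {true} ()
∧-false {false} ()

∧-not-≡false : ∀ a {b} → b ≡ true → (a ∧ not b) ≡ false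
∧-not-≡false true refl = refl
∧-not-≡false false refl = refl

∧-≡false : ∀ {a} b → a ≡ false → (a ∧ b) ≡ false
∧-≡false b refl = refl

if-cong : ∀ {a b : Bool} (u v : ℕ) → a ≡ b → (if a then u else v) ≡ (if b then u else v)
if-cong u v refl = refl

∈ᵇ-head : ∀ {n} (x : Fin n) xs → x ∈ᵇ (x ∷ xs) ≡ true
∈ᵇ-head x xs rewrite dec-true (x ≟F x) refl = refl

∈ᵇ-tail : ∀ {n} {x y : Fin n} ys → x ≢ y → x ∈ᵇ (y ∷ ys) ≡ x ∈ᵇ ys
∈ᵇ-tail {x = x} {y} ys x≢y rewrite dec-false (x ≟F y) x≢y = refl

∈ᵇ-false⇒All≢ : ∀ {n} {x : Fin n} xs → x ∈ᵇ xs ≡ false → All (x ≢_) xs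
∈ᵇ-false⇒All≢ [] _ = []
∈ᵇ-false⇒All≢ {x = x} (y ∷ ys) e with x ≟F y
∈ᵇ-false⇒All≢ (y ∷ ys) () | yes _
∈ᵇ-false⇒All≢ (y ∷ ys) e  | no x≢y = x≢y ∷ ∈ᵇ-false⇒All≢ ys e

All≢⇒∈ᵇ-false : ∀ {n} {x : Fin n} xs → All (x ≢_) xs → x ∈ᵇ xs ≡ false
All≢⇒∈ᵇ-false [] [] = refl
All≢⇒∈ᵇ-false (y ∷ ys) (x≢y ∷ x∉ys) = trans (∈ᵇ-tail ys x≢y) (All≢⇒∈ᵇ-false ys x∉ys)

∈ᵇ-true⇒∈ : ∀ {n} {x : Fin n} xs → x ∈ᵇ xs ≡ true → x ∈ xs
∈ᵇ-true⇒∈ [] ()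
∈ᵇ-true⇒∈ {x = x} (y ∷ ys) e with x ≟F y
... | yes refl = here refl
... | no _ = there (∈ᵇ-true⇒∈ ys e)

↭-allFin : ∀ {n} {xs : List (Fin n)} → Unique xs → (∀ x → x ∈ᵇ xs ≡ true) → xs ↭ allFin n
↭-allFin {n} {xs} xs-unique every =
  ∼bag⇒↭ (unique∧set⇒bag xs-unique (allFin⁺ n)
    (mk⇔ (λ _ → ∈-allFin _) (λ _ → ∈ᵇ-true⇒∈ xs (every _))))

count : ∀ n → (Fin n → Bool) → ℕ
count zero p = 0
count (suc n) p = (if p zero then 1 else 0) + count n (λ x → p (suc x))

count-cong : ∀ n {p q : Fin n → Bool} → (∀ x → p x ≡ q x) → count n p ≡ count n q
count-cong zero e = refl
count-cong (suc n) e =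
  cong₂ _+_ (cong (λ b → if b then 1 else 0) (e zero)) (count-cong n (λ x → e (suc x)))

count-none : ∀ n (p : Fin n → Bool) → (∀ x → p x ≡ false) → count n p ≡ 0
count-none zero p e = refl
count-none (suc n) p e rewrite e zero = count-none n _ (λ x → e (suc x))

count≡0⇒none : ∀ n (p : Fin n → Bool) → count n p ≡ 0 → ∀ x → p x ≡ false
count≡0⇒none (suc n) p e x with p zero in p0
count≡0⇒none (suc n) p () x | true
count≡0⇒none (suc n) p e zero | false = p0
count≡0⇒none (suc n) p e (suc x) | false = count≡0⇒none n _ e x

count-≤ : ∀ n (p : Fin n → Bool) → count n p ≤ n
count-≤ zero p = z≤n
count-≤ (suc n) p with p zero
... | true = s≤s (count-≤ n _)
... | false = ℕₚ.m≤n⇒m≤1+n (count-≤ n _)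

count≡n⇒all : ∀ n (p : Fin n → Bool) → count n p ≡ n → ∀ x → p x ≡ true
count≡n⇒all (suc n) p e x with p zero in p0
count≡n⇒all (suc n) p e zero | true = p0
count≡n⇒all (suc n) p e (suc x) | true = count≡n⇒all n _ (ℕₚ.suc-injective e) x
count≡n⇒all (suc n) p e x | false =
  ⊥-elim (ℕₚ.<⇒≱ (ℕₚ.n<1+n n) (subst (_≤ n) e (count-≤ n _)))

count≡suc⇒some : ∀ n (p : Fin n → Bool) {h} → count n p ≡ suc h → ∃ λ x → p x ≡ true
count≡suc⇒some (suc n) p e with p zero in p0
... | true = zero , p0
... | false with count≡suc⇒some n _ e
...   | x , px = suc x , px

count-flip : ∀ n (p q : Fin n → Bool) (j : Fin n) → p j ≡ false → q j ≡ true →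
  (∀ x → x ≢ j → p x ≡ q x) → count n q ≡ suc (count n p)
count-flip (suc n) p q zero pj qj e rewrite pj | qj =
  cong suc (count-cong n (λ x → sym (e (suc x) (λ ()))))
count-flip (suc n) p q (suc j) pj qj e rewrite e zero (λ ()) with q zero
... | true = cong suc (count-flip n _ _ j pj qj (λ x x≢j → e (suc x) (λ eq → x≢j (Finₚ.suc-injective eq))))
... | false = count-flip n _ _ j pj qj (λ x x≢j → e (suc x) (λ eq → x≢j (Finₚ.suc-injective eq)))

length-unique : ∀ {n} (xs : List (Fin n)) → Unique xs → length xs ≡ count n (_∈ᵇ xs)
length-unique {n} [] [] = sym (count-none n _ (λ x → refl))
length-unique {n} (y ∷ ys) (y∉ys ∷ ys-unique) =
  trans (cong suc (length-unique ys ys-unique))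
    (sym (count-flip n _ _ y (All≢⇒∈ᵇ-false ys y∉ys) (∈ᵇ-head y ys) (λ x x≢y → sym (∈ᵇ-tail ys x≢y))))

first-map : ∀ {A B : Set} (p : B → Bool) (g : A → B) xs →
  first p (map g xs) ≡ Maybe.map g (first (λ x → p (g x)) xs)
first-map p g [] = refl
first-map p g (x ∷ xs) with p (g x)
... | true = refl
... | false = first-map p g xs

first-cong : ∀ {A : Set} {p q : A → Bool} xs → (∀ x → p x ≡ q x) → first p xs ≡ first q xs
first-cong [] e = refl
first-cong {p = p} {q} (x ∷ xs) e rewrite e x with q x
... | true = refl
... | false = first-cong xs e

first-none : ∀ {A : Set} {p : A → Bool} xs → (∀ x → p x ≡ false) → first p xs ≡ nothing
first-none [] e = refl
first-none (x ∷ xs) e rewrite e x = first-none xs e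

first-just : ∀ {A : Set} (p : A → Bool) xs {r} → first p xs ≡ just r → p r ≡ true
first-just p (x ∷ xs) e with p x in px
first-just p (x ∷ xs) refl | true = px
... | false = first-just p xs e

first-allFin-suc : ∀ n (p : Fin (suc n) → Bool) →
  first p (allFin (suc n)) ≡ (if p zero then just zero else Maybe.map suc (first (λ x → p (suc x)) (allFin n)))
first-allFin-suc n p with p zero
... | true = refl
... | false = trans (cong (first p) (sym (Listₚ.map-tabulate (λ x → x) suc))) (first-map p suc (allFin n))

first-allFin-least : ∀ {n} (p : Fin n → Bool) (r : Fin n) → p r ≡ true →
  (∀ x → x Fin.< r → p x ≡ false) → first p (allFin n) ≡ just r
first-allFin-least {suc n} p zero pr below rewrite first-allFin-suc n p | pr = refl
first-allFin-least {suc n} p (suc r) pr below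
  rewrite first-allFin-suc n p | below zero (s≤s z≤n)
        | first-allFin-least (λ x → p (suc x)) r pr (λ x x<r → below (suc x) (s≤s x<r)) = refl

least-witness : ∀ {n} (p : Fin n → Bool) (x : Fin n) → p x ≡ true →
  ∃ λ r → p r ≡ true × (∀ z → z Fin.< r → p z ≡ false)
least-witness {suc n} p zero px = zero , px , λ _ ()
least-witness {suc n} p (suc x) px with p zero in p0
... | true = zero , p0 , λ _ ()
... | false with least-witness (λ y → p (suc y)) x px
...   | r , pr , below = suc r , pr , below′
  where
  below′ : ∀ z → z Fin.< suc r → p z ≡ false
  below′ zero _ = p0
  below′ (suc z) (s≤s z<r) = below z z<r

first-allFin-just : ∀ {n} (p : Fin n → Bool) (x : Fin n) → p x ≡ true →
  ∃ λ r → first p (allFin n) ≡ just r × p r ≡ true × (∀ z → z Fin.< r → p z ≡ false)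
first-allFin-just p x px with least-witness p x px
... | r , pr , below = r , first-allFin-least p r pr below , pr , below

first-allFin-nothing : ∀ {n} (p : Fin n → Bool) → first p (allFin n) ≡ nothing → ∀ x → p x ≡ false
first-allFin-nothing p e x with p x in px
... | false = refl
... | true with first-allFin-just p x px
...   | r , found , _ with trans (sym found) e
...     | ()

hasEntry : ∀ {n} → Fin 2 → Tableau n → ℕ → Fin n → Bool
hasEntry c τ m r = does (τ r c ℕ.≟ m)

stepAt-first : ∀ n τ m →
  stepAt n τ m ≡ maybe (λ _ → up) (maybe down up (first (hasEntry col1 τ m) (allFin n)))
                       (first (hasEntry col2 τ m) (allFin n))
stepAt-first n τ m with first (hasEntry col2 τ m) (allFin n)
... | just _ = refl
... | nothing with first (hasEntry col1 τ m) (allFin n)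
...   | just _ = refl
...   | nothing = refl

stepAt-up : ∀ n τ m r → τ r col2 ≡ m → stepAt n τ m ≡ up
stepAt-up n τ m r e rewrite stepAt-first n τ m
  with first-allFin-just (hasEntry col2 τ m) r (dec-true (τ r col2 ℕ.≟ m) e)
... | _ , found , _ rewrite found = refl

stepAt-down : ∀ n τ m j → τ j col1 ≡ m → (∀ r → τ r col2 ≢ m) → (∀ r → τ r col1 ≡ m → r ≡ j) →
  stepAt n τ m ≡ down j
stepAt-down n τ m j e no-up unique rewrite stepAt-first n τ m
  | first-none {p = hasEntry col2 τ m} (allFin n) (λ r → dec-false (τ r col2 ℕ.≟ m) (no-up r))
  | first-allFin-least (hasEntry col1 τ m) j (dec-true (τ j col1 ℕ.≟ m) e)
      (λ x x<j → dec-false (τ x col1 ℕ.≟ m) (λ ex → Finₚ.<-irrefl (unique x ex) x<j)) = refl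

stepAt-cong : ∀ n τ σ m → (∀ r c → hasEntry c τ m r ≡ hasEntry c σ m r) →
  stepAt n τ m ≡ stepAt n σ m
stepAt-cong n τ σ m e rewrite stepAt-first n τ m | stepAt-first n σ m
  | first-cong {p = hasEntry col2 τ m} {q = hasEntry col2 σ m} (allFin n) (λ r → e r col2)
  | first-cong {p = hasEntry col1 τ m} {q = hasEntry col1 σ m} (allFin n) (λ r → e r col1) = refl

interval : ℕ → ℕ → List ℕ
interval k zero = []
interval k (suc l) = k ∷ interval (suc k) l

map-suc-interval : ∀ k l → map suc (interval k l) ≡ interval (suc k) l
map-suc-interval k zero = refl
map-suc-interval k (suc l) = cong (suc k ∷_) (map-suc-interval (suc k) l)

applyUpTo-interval : ∀ {A : Set} (f : ℕ → A) l → applyUpTo f l ≡ map f (interval 0 l)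
applyUpTo-interval f zero = refl
applyUpTo-interval f (suc l) = cong (f 0 ∷_) (begin
  applyUpTo (λ i → f (suc i)) l         ≡⟨ applyUpTo-interval (λ i → f (suc i)) l ⟩
  map (λ i → f (suc i)) (interval 0 l)  ≡⟨ Listₚ.map-∘ (interval 0 l) ⟩
  map f (map suc (interval 0 l))        ≡⟨ cong (map f) (map-suc-interval 0 l) ⟩
  map f (interval 1 l)                  ∎)
  where open ≡-Reasoning

map-suc-upTo : ∀ l → map suc (upTo l) ≡ interval 1 l
map-suc-upTo l = begin
  map suc (upTo l)                       ≡⟨ cong (map suc) (applyUpTo-interval (λ x → x) l) ⟩
  map suc (map (λ x → x) (interval 0 l)) ≡⟨ cong (map suc) (Listₚ.map-id (interval 0 l)) ⟩
  map suc (interval 0 l)                 ≡⟨ map-suc-interval 0 l ⟩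
  interval 1 l                           ∎
  where open ≡-Reasoning

length-map-interval : ∀ {A : Set} (f : ℕ → A) k l → length (map f (interval k l)) ≡ l
length-map-interval f k zero = refl
length-map-interval f k (suc l) = cong suc (length-map-interval f (suc k) l)

map-interval-cong : ∀ {A : Set} (f g : ℕ → A) k l → (∀ m → k ≤ m → f m ≡ g m) →
  map f (interval k l) ≡ map g (interval k l)
map-interval-cong f g k zero e = refl
map-interval-cong f g k (suc l) e =
  cong₂ _∷_ (e k ℕₚ.≤-refl) (map-interval-cong f g (suc k) l (λ m k<m → e m (ℕₚ.<⇒≤ k<m)))

module _ {n : ℕ} (τ : Tableau (suc n))
         (in-range : ∀ i c → 1 ≤ τ i c × τ i c ≤ 2 * suc n)
         (injective : ∀ i j c d → τ i c ≡ τ j d → i ≡ j × c ≡ d)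
         {m : ℕ} (1≤m : 1 ≤ m) (m≤2n : m ≤ 2 * suc n) where

  private
    code : ∀ v → 1 ≤ v → v ≤ 2 * suc n → Fin (suc n * 2)
    code zero () _
    code (suc v) _ v<2n = Fin.fromℕ< (subst (v <_) (ℕₚ.*-comm 2 (suc n)) v<2n)

    code-injective : ∀ {v w} p q p′ q′ → code v p q ≡ code w p′ q′ → v ≡ w
    code-injective {zero} () _ _ _ _
    code-injective {suc v} {zero} _ _ () _ _
    code-injective {suc v} {suc w} p q p′ q′ e = cong suc (begin
      v                            ≡⟨ Finₚ.toℕ-fromℕ< _ ⟨
      Fin.toℕ (code (suc v) p q)   ≡⟨ cong Fin.toℕ e ⟩
      Fin.toℕ (code (suc w) p′ q′) ≡⟨ Finₚ.toℕ-fromℕ< _ ⟩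
      w                            ∎)
      where open ≡-Reasoning

    cell : Fin (suc n * 2) → Fin (suc n) × Fin 2
    cell = Fin.remQuot {suc n} 2

    entry : Fin (suc n * 2) → ℕ
    entry x = τ (proj₁ (cell x)) (proj₂ (cell x))

    entry-code : Fin (suc n * 2) → Fin (suc n * 2)
    entry-code x = code (entry x) (proj₁ (in-range _ _)) (proj₂ (in-range _ _))

    entry-injective : ∀ {x y} → entry x ≡ entry y → x ≡ y
    entry-injective {x} {y} e with injective _ _ _ _ e
    ... | same-row , same-column = begin
      x                           ≡⟨ Finₚ.combine-remQuot {suc n} 2 x ⟨
      uncurry Fin.combine (cell x) ≡⟨ cong (uncurry Fin.combine) (cong₂ _,_ same-row same-column) ⟩
      uncurry Fin.combine (cell y) ≡⟨ Finₚ.combine-remQuot {suc n} 2 y ⟩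
      y                           ∎
      where open ≡-Reasoning

    m≢entry : (∀ i c → τ i c ≢ m) → ∀ x → code m 1≤m m≤2n ≢ entry-code x
    m≢entry missing x e = missing _ _ (sym (code-injective _ _ _ _ e))

  missing-entry-absurd : (∀ i c → τ i c ≢ m) → ⊥
  missing-entry-absurd missing
    with Finₚ.pigeonhole (ℕₚ.n<1+n _) (λ x → Fin.punchOut (m≢entry missing x))
  ... | x , y , x<y , same =
    Finₚ.<-irrefl (entry-injective (code-injective _ _ _ _ same-code)) x<y
    where
    same-code : code (entry x) _ _ ≡ code (entry y) _ _
    same-code = Finₚ.punchOut-injective (m≢entry missing x) (m≢entry missing y) same

entry-column : ∀ {n} (τ : Tableau n) → IsSPCT n τ → ∀ m → 1 ≤ m → m ≤ 2 * n →
  (∃ λ r → τ r col2 ≡ m) ⊎ (∃ λ j → τ j col1 ≡ m)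
entry-column {n} τ spct m 1≤m m≤2n with first (hasEntry col2 τ m) (allFin n) in found₂
... | just r = inj₁ (r , does-true⇒ (τ r col2 ℕ.≟ m) (first-just (hasEntry col2 τ m) (allFin n) found₂))
... | nothing with first (hasEntry col1 τ m) (allFin n) in found₁
...   | just j = inj₂ (j , does-true⇒ (τ j col1 ℕ.≟ m) (first-just (hasEntry col1 τ m) (allFin n) found₁))
...   | nothing = ⊥-elim (absent n τ spct m≤2n (no-entry found₁ found₂))
  where
  absent : ∀ n (τ : Tableau n) → IsSPCT n τ → m ≤ 2 * n → (∀ i c → τ i c ≢ m) → ⊥
  absent zero τ spct m≤0 _ = ℕₚ.<⇒≱ 1≤m m≤0
  absent (suc n) τ spct m≤2n = missing-entry-absurd τ (proj₁ spct) (proj₁ (proj₂ spct)) 1≤m m≤2n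

  no-entry : first (hasEntry col1 τ m) (allFin n) ≡ nothing → first (hasEntry col2 τ m) (allFin n) ≡ nothing →
    ∀ i c → τ i c ≢ m
  no-entry none₁ _ i zero e =
    true≢false (trans (sym (dec-true (τ i col1 ℕ.≟ m) e)) (first-allFin-nothing _ none₁ i))
  no-entry _ none₂ i (suc zero) e =
    true≢false (trans (sym (dec-true (τ i col2 ℕ.≟ m) e)) (first-allFin-nothing _ none₂ i))

module _ {n : ℕ} where

  labelled : List (Step n) → List (LStep n)
  labelled s = proj₁ (labelGo s)

  𝔇 𝔘 : List (Step n) → List (Fin n)
  𝔇 s = proj₁ (proj₂ (labelGo s))
  𝔘 s = proj₂ (proj₂ (labelGo s))

  𝔇≡downLabels : ∀ s → 𝔇 s ≡ downLabels s
  𝔇≡downLabels [] = refl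
  𝔇≡downLabels (up ∷ s) = 𝔇≡downLabels s
  𝔇≡downLabels (down j ∷ s) = cong (j ∷_) (𝔇≡downLabels s)

  available : List (Fin n) → List (Fin n) → Fin n → Bool
  available ds us x = (x ∈ᵇ ds) ∧ not (x ∈ᵇ us)

  dyck-length : ∀ h (s : List (Step n)) → DyckFrom h s → h + length s ≡ 2 * length (downLabels s)
  dyck-length h [] refl = refl
  dyck-length h (up ∷ s) d = trans (ℕₚ.+-suc h (length s)) (dyck-length (suc h) s d)
  dyck-length (suc h) (down j ∷ s) d = cong suc (begin
    h + suc (length s)       ≡⟨ ℕₚ.+-suc h (length s) ⟩
    suc (h + length s)       ≡⟨ cong suc (dyck-length h s d) ⟩
    suc (l + (l + 0))        ≡⟨ ℕₚ.+-suc l (l + 0) ⟨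
    l + suc (l + 0)          ∎)
    where
    l : ℕ
    l = length (downLabels s)
    open ≡-Reasoning

  -- Θ of a labelled suffix whose first step is at position k; cells of absent labels are 0.
  tableauFrom : ℕ → List (LStep n) → Tableau n
  tableauFrom k L i zero = posFrom k (isDownL i) L
  tableauFrom k L i (suc _) = posFrom k (isUpL i) L

  Θ≡tableauFrom : ∀ s i c → Θ n s i c ≡ tableauFrom 1 (labelled s) i c
  Θ≡tableauFrom s i zero = refl
  Θ≡tableauFrom s i (suc zero) = refl

module TableauToPath {n : ℕ} (τ : Tableau n) (τ-spct : IsSPCT n τ) where

  in-range : ∀ i c → 1 ≤ τ i c × τ i c ≤ 2 * n
  in-range = proj₁ τ-spct

  injective : ∀ i j c d → τ i c ≡ τ j d → i ≡ j × c ≡ d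
  injective = proj₁ (proj₂ τ-spct)

  row-decreasing : ∀ i → τ i col2 < τ i col1
  row-decreasing = proj₁ (proj₂ (proj₂ τ-spct))

  triple : ∀ i r → i Fin.< r → τ r col2 ≤ τ i col1 → τ r col2 < τ i col2
  triple = proj₂ (proj₂ (proj₂ τ-spct))

  col1≢col2 : ∀ i j → τ i col1 ≢ τ j col2
  col1≢col2 i j e with injective i j col1 col2 e
  ... | _ , ()

  column-injective : ∀ c {i j} → τ i c ≡ τ j c → i ≡ j
  column-injective c {i} {j} e = proj₁ (injective i j c c e)

  col1≢ : ∀ {k r} → τ r col2 ≡ k → ∀ x → τ x col1 ≢ k
  col1≢ {r = r} r-at-k x e = col1≢col2 x r (trans e (sym r-at-k))

  col2≢ : ∀ {k j} → τ j col1 ≡ k → ∀ x → τ x col2 ≢ k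
  col2≢ {j = j} j-at-k x e = col1≢col2 j x (trans j-at-k (sym e))

  same-column≢ : ∀ c {k j} → τ j c ≡ k → ∀ x → x ≢ j → τ x c ≢ k
  same-column≢ c j-at-k x x≢j e = x≢j (column-injective c (trans e (sym j-at-k)))

  downIn upIn isOpen : ℕ → Fin n → Bool
  downIn k x = does (k ≤? τ x col1)
  upIn k x = does (k ≤? τ x col2)
  isOpen k x = downIn k x ∧ not (upIn k x)

  height : ℕ → ℕ
  height k = count n (isOpen k)

  record InvariantOn (k : ℕ) (s : List (Step n)) (L : List (LStep n)) (us : List (Fin n)) : Set where
    field
      downLabels≡ : ∀ x → x ∈ᵇ downLabels s ≡ downIn k x
      downLabels-unique : Unique (downLabels s)
      ups≡ : ∀ x → x ∈ᵇ us ≡ upIn k x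
      col1≡ : ∀ i → tableauFrom k L i col1 ≡ (if downIn k i then τ i col1 else 0)
      col2≡ : ∀ i → tableauFrom k L i col2 ≡ (if upIn k i then τ i col2 else 0)
      dyck : DyckFrom (height k) s

  Invariant : ℕ → List (Step n) → Set
  Invariant k s = InvariantOn k s (labelled s) (𝔘 s)

  module UpStep {k : ℕ} {r : Fin n} {s : List (Step n)} (r-at-k : τ r col2 ≡ k) (I : Invariant (suc k) s) where
    open InvariantOn I

    upIn-r : upIn k r ≡ true
    upIn-r = dec-true (k ≤? τ r col2) (ℕₚ.≤-reflexive (sym r-at-k))

    r-open : isOpen (suc k) r ≡ true
    r-open rewrite dec-true (suc k ≤? τ r col1) (subst (_< τ r col1) r-at-k (row-decreasing r))
                 | dec-false (suc k ≤? τ r col2) (ℕₚ.<⇒≱ (s≤s (ℕₚ.≤-reflexive r-at-k))) = refl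

    below-r-closed : ∀ x → x Fin.< r → isOpen (suc k) x ≡ false
    below-r-closed x x<r with suc k ≤? τ x col1
    ... | no k≮col1 = ∧-≡false _ (dec-false (suc k ≤? τ x col1) k≮col1)
    ... | yes k<col1 = ∧-not-≡false _ (dec-true (suc k ≤? τ x col2)
      (subst (_< τ x col2) r-at-k (triple x r x<r (subst (_≤ τ x col1) (sym r-at-k) (ℕₚ.<⇒≤ k<col1)))))

    least-available : minDiff (𝔇 s) (𝔘 s) ≡ just r
    least-available =
      trans (first-cong (allFin n) available≡open) (first-allFin-least (isOpen (suc k)) r r-open below-r-closed)
      where
      available≡open : ∀ x → available (𝔇 s) (𝔘 s) x ≡ isOpen (suc k) x
      available≡open x =
        cong₂ (λ a b → a ∧ not b) (trans (cong (x ∈ᵇ_) (𝔇≡downLabels s)) (downLabels≡ x)) (ups≡ x)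

    height-suc : height (suc k) ≡ suc (height k)
    height-suc = count-flip n _ _ r (∧-not-≡false _ upIn-r) r-open
      (λ x x≢r → cong₂ (λ a b → a ∧ not b) (≤?-suc (col1≢ r-at-k x)) (≤?-suc (same-column≢ col2 r-at-k x x≢r)))

    ups′ : ∀ x → x ∈ᵇ (r ∷ 𝔘 s) ≡ upIn k x
    ups′ x with x ≟F r
    ... | yes refl = sym upIn-r
    ... | no x≢r = trans (ups≡ x) (sym (≤?-suc (same-column≢ col2 r-at-k x x≢r)))

    col2′ : ∀ i → tableauFrom k (U (just r) ∷ labelled s) i col2 ≡ (if upIn k i then τ i col2 else 0)
    col2′ i with i ≟F r
    ... | yes refl = trans (sym r-at-k) (if-cong (τ r col2) 0 (sym upIn-r))
    ... | no i≢r = trans (col2≡ i) (if-cong _ _ (sym (≤?-suc (same-column≢ col2 r-at-k i i≢r))))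

    invariant : InvariantOn k (up ∷ s) (U (just r) ∷ labelled s) (r ∷ 𝔘 s)
    invariant = record
      { downLabels≡ = λ x → trans (downLabels≡ x) (sym (≤?-suc (col1≢ r-at-k x)))
      ; downLabels-unique = downLabels-unique
      ; ups≡ = ups′
      ; col1≡ = λ i → trans (col1≡ i) (if-cong _ _ (sym (≤?-suc (col1≢ r-at-k i))))
      ; col2≡ = col2′
      ; dyck = subst (λ h → DyckFrom h s) height-suc dyck
      }

  upStep : ∀ {k r s} → τ r col2 ≡ k → Invariant (suc k) s → Invariant k (up ∷ s)
  upStep {k} {r} {s} r-at-k I =
    subst (λ md → InvariantOn k (up ∷ s) (U md ∷ labelled s) (maybe (_∷ 𝔘 s) (𝔘 s) md))
      (sym (UpStep.least-available r-at-k I)) (UpStep.invariant r-at-k I)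

  module DownStep {k : ℕ} {j : Fin n} {s : List (Step n)} (j-at-k : τ j col1 ≡ k) (I : Invariant (suc k) s) where
    open InvariantOn I

    downIn-j : downIn k j ≡ true
    downIn-j = dec-true (k ≤? τ j col1) (ℕₚ.≤-reflexive (sym j-at-k))

    downIn-suc-j : downIn (suc k) j ≡ false
    downIn-suc-j = dec-false (suc k ≤? τ j col1) (ℕₚ.<⇒≱ (s≤s (ℕₚ.≤-reflexive j-at-k)))

    upIn-j : upIn k j ≡ false
    upIn-j = dec-false (k ≤? τ j col2) (ℕₚ.<⇒≱ (subst (τ j col2 <_) j-at-k (row-decreasing j)))

    height-suc : height k ≡ suc (height (suc k))
    height-suc = count-flip n _ _ j (∧-≡false _ downIn-suc-j) (cong₂ (λ a b → a ∧ not b) downIn-j upIn-j)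
      (λ x x≢j → cong₂ (λ a b → a ∧ not b)
        (sym (≤?-suc (same-column≢ col1 j-at-k x x≢j))) (sym (≤?-suc (col2≢ j-at-k x))))

    downs′ : ∀ x → x ∈ᵇ (j ∷ downLabels s) ≡ downIn k x
    downs′ x with x ≟F j
    ... | yes refl = sym downIn-j
    ... | no x≢j = trans (downLabels≡ x) (sym (≤?-suc (same-column≢ col1 j-at-k x x≢j)))

    col1′ : ∀ i → tableauFrom k (D j ∷ labelled s) i col1 ≡ (if downIn k i then τ i col1 else 0)
    col1′ i with i ≟F j
    ... | yes refl = trans (sym j-at-k) (if-cong (τ j col1) 0 (sym downIn-j))
    ... | no i≢j = trans (col1≡ i) (if-cong _ _ (sym (≤?-suc (same-column≢ col1 j-at-k i i≢j))))

    invariant : Invariant k (down j ∷ s)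
    invariant = record
      { downLabels≡ = downs′
      ; downLabels-unique = ∈ᵇ-false⇒All≢ _ (trans (downLabels≡ j) downIn-suc-j) ∷ downLabels-unique
      ; ups≡ = λ x → trans (ups≡ x) (sym (≤?-suc (col2≢ j-at-k x)))
      ; col1≡ = col1′
      ; col2≡ = λ i → trans (col2≡ i) (if-cong _ _ (sym (≤?-suc (col2≢ j-at-k i))))
      ; dyck = subst (λ h → DyckFrom h (down j ∷ s)) (sym height-suc) dyck
      }

  invariant-end : Invariant (suc (2 * n)) []
  invariant-end = record
    { downLabels≡ = λ x → sym (beyond-end col1 x)
    ; downLabels-unique = []
    ; ups≡ = λ x → sym (beyond-end col2 x)
    ; col1≡ = λ i → if-cong _ _ (sym (beyond-end col1 i))
    ; col2≡ = λ i → if-cong _ _ (sym (beyond-end col2 i))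
    ; dyck = count-none n _ (λ x → ∧-≡false _ (beyond-end col1 x))
    }
    where
    beyond-end : ∀ c x → does (suc (2 * n) ≤? τ x c) ≡ false
    beyond-end c x = dec-false (suc (2 * n) ≤? τ x c) (ℕₚ.<⇒≱ (s≤s (proj₂ (in-range x c))))

  suffix : ℕ → ℕ → List (Step n)
  suffix k l = map (stepAt n τ) (interval k l)

  suffix-invariant : ∀ l k → 1 ≤ k → k + l ≡ suc (2 * n) → Invariant k (suffix k l)
  suffix-invariant zero k _ k+0≡ =
    subst (λ k → Invariant k []) (trans (sym k+0≡) (ℕₚ.+-identityʳ k)) invariant-end
  suffix-invariant (suc l) k 1≤k k+l≡ =
    extend (entry-column τ τ-spct k 1≤k k≤2n) (suffix-invariant l (suc k) (s≤s z≤n) k+l≡′)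
    where
    k+l≡′ : suc k + l ≡ suc (2 * n)
    k+l≡′ = trans (sym (ℕₚ.+-suc k l)) k+l≡

    k≤2n : k ≤ 2 * n
    k≤2n = subst (k ≤_) (ℕₚ.suc-injective k+l≡′) (ℕₚ.m≤m+n k l)

    extend : (∃ λ r → τ r col2 ≡ k) ⊎ (∃ λ j → τ j col1 ≡ k) → Invariant (suc k) (suffix (suc k) l) →
      Invariant k (stepAt n τ k ∷ suffix (suc k) l)
    extend (inj₁ (r , r-at-k)) I rewrite stepAt-up n τ k r r-at-k = upStep r-at-k I
    extend (inj₂ (j , j-at-k)) I
      rewrite stepAt-down n τ k j j-at-k (col2≢ j-at-k) (λ x e → column-injective col1 (trans e (sym j-at-k)))
      = DownStep.invariant j-at-k I

  Φ-correct : IsLDyck n (Φ n τ) × (∀ i c → Θ n (Φ n τ) i c ≡ τ i c)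
  Φ-correct = subst (λ path → IsLDyck n path × (∀ i c → Θ n path i c ≡ τ i c)) (sym Φ≡suffix)
    ((length-map-interval (stepAt n τ) 1 (2 * n) , subst (λ h → DyckFrom h (suffix 1 (2 * n))) height-1 dyck ,
      downLabels-unique) , Θ≡τ)
    where
    Φ≡suffix : Φ n τ ≡ suffix 1 (2 * n)
    Φ≡suffix = cong (map (stepAt n τ)) (map-suc-upTo (2 * n))

    open InvariantOn (suffix-invariant (2 * n) 1 (s≤s z≤n) refl)

    height-1 : height 1 ≡ 0
    height-1 = count-none n _ (λ x → ∧-not-≡false _ (dec-true (1 ≤? τ x col2) (proj₁ (in-range x col2))))

    Θ≡τ : ∀ i c → Θ n (suffix 1 (2 * n)) i c ≡ τ i c
    Θ≡τ i zero = trans (col1≡ i) (if-cong _ _ (dec-true (1 ≤? τ i col1) (proj₁ (in-range i col1))))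
    Θ≡τ i (suc zero) = trans (col2≡ i) (if-cong _ _ (dec-true (1 ≤? τ i col2) (proj₁ (in-range i col2))))

module _ {n : ℕ} where

  ZeroOrAtLeast : Tableau n → ℕ → Set
  ZeroOrAtLeast σ k = ∀ i c → σ i c ≡ 0 ⊎ k ≤ σ i c

  InjectiveOnNonzero : Tableau n → Set
  InjectiveOnNonzero σ = ∀ i j c d → σ i c ≡ σ j d → σ i c ≢ 0 → i ≡ j × c ≡ d

  AgreeExcept : Fin n → Fin 2 → Tableau n → Tableau n → Set
  AgreeExcept i₀ c₀ σ σ′ = ∀ i c → ¬ (i ≡ i₀ × c ≡ c₀) → σ′ i c ≡ σ i c

  module _ {σ σ′ : Tableau n} {i₀ : Fin n} {c₀ : Fin 2} {k : ℕ} (1≤k : 1 ≤ k)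
           (σ′-new : σ′ i₀ c₀ ≡ k) (agree : AgreeExcept i₀ c₀ σ σ′) where

    agree-≢k : ∀ {i c} → σ′ i c ≢ k → σ′ i c ≡ σ i c
    agree-≢k {i} {c} ≢k = agree i c λ { (refl , refl) → ≢k σ′-new }

    only-new-cell-is-k : ZeroOrAtLeast σ (suc k) → ∀ i c → σ′ i c ≡ k → i ≡ i₀ × c ≡ c₀
    only-new-cell-is-k bound i c σ′≡k with (i ≟F i₀) ×-dec (c ≟F c₀)
    ... | yes same = same
    ... | no other with bound i c | trans (sym (agree i c other)) σ′≡k
    ...   | inj₁ σ≡0 | σ≡k = ⊥-elim (ℕₚ.<⇒≱ 1≤k (ℕₚ.≤-reflexive (trans (sym σ≡k) σ≡0)))
    ...   | inj₂ k<σ | σ≡k = ⊥-elim (ℕₚ.<-irrefl (sym σ≡k) k<σ)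

    injectiveOnNonzero-extend : ZeroOrAtLeast σ (suc k) → InjectiveOnNonzero σ → InjectiveOnNonzero σ′
    injectiveOnNonzero-extend bound injective i j c d e ≢0 with σ′ i c ℕ.≟ k
    ... | yes σ′≡k with only-new-cell-is-k bound i c σ′≡k | only-new-cell-is-k bound j d (trans (sym e) σ′≡k)
    ...   | refl , refl | refl , refl = refl , refl
    injectiveOnNonzero-extend bound injective i j c d e ≢0 | no σ′≢k =
      injective i j c d (trans (sym (agree-≢k σ′≢k)) (trans e (agree-≢k (λ σ′≡k → σ′≢k (trans e σ′≡k)))))
        (λ σ≡0 → ≢0 (trans (agree-≢k σ′≢k) σ≡0))

    stepAt-beyond : σ i₀ c₀ ≡ 0 → ∀ m → k < m → stepAt n σ′ m ≡ stepAt n σ m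
    stepAt-beyond σ-unset m k<m = stepAt-cong n σ′ σ m same-entries
      where
      same-entries : ∀ r c → hasEntry c σ′ m r ≡ hasEntry c σ m r
      same-entries r c with (r ≟F i₀) ×-dec (c ≟F c₀)
      ... | yes (refl , refl) =
        trans (dec-false (σ′ i₀ c₀ ℕ.≟ m) (λ σ′≡m → ℕₚ.<-irrefl (trans (sym σ′-new) σ′≡m) k<m))
          (sym (dec-false (σ i₀ c₀ ℕ.≟ m)
            (λ σ≡m → ℕₚ.<⇒≱ (ℕₚ.≤-trans 1≤k (ℕₚ.<⇒≤ k<m)) (ℕₚ.≤-reflexive (trans (sym σ≡m) σ-unset)))))
      ... | no other = cong (λ v → does (v ℕ.≟ m)) (agree r c other)

module PathToTableau {n : ℕ} where

  record InvariantOn (k h : ℕ) (s : List (Step n)) (L : List (LStep n)) (ds us : List (Fin n)) : Set where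
    field
      ups-labelled : upLabelList L ≡ map just us
      ups-unique : Unique us
      ups⊆downs : ∀ x → x ∈ᵇ us ≡ true → x ∈ᵇ ds ≡ true
      height≡ : count n (available ds us) ≡ h
      col1-range : ∀ i → i ∈ᵇ ds ≡ true → k ≤ tableauFrom k L i col1 × tableauFrom k L i col1 ≤ 2 * n
      col1-unset : ∀ i → i ∈ᵇ ds ≡ false → tableauFrom k L i col1 ≡ 0
      col2-range : ∀ i → i ∈ᵇ us ≡ true →
        k ≤ tableauFrom k L i col2 × tableauFrom k L i col2 < tableauFrom k L i col1
      col2-unset : ∀ i → i ∈ᵇ us ≡ false → tableauFrom k L i col2 ≡ 0
      injective : InjectiveOnNonzero (tableauFrom k L)
      triple : ∀ i r → i Fin.< r → i ∈ᵇ us ≡ true → r ∈ᵇ us ≡ true →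
        tableauFrom k L r col2 ≤ tableauFrom k L i col1 → tableauFrom k L r col2 < tableauFrom k L i col2
      available-before : ∀ i r → i Fin.< r → available ds us i ≡ true → r ∈ᵇ us ≡ true →
        tableauFrom k L i col1 < tableauFrom k L r col2
      Φ-suffix : map (stepAt n (tableauFrom k L)) (interval k (length s)) ≡ s

    zeroOrAtLeast : ZeroOrAtLeast (tableauFrom k L) k
    zeroOrAtLeast i zero with i ∈ᵇ ds in e
    ... | true = inj₂ (proj₁ (col1-range i e))
    ... | false = inj₁ (col1-unset i e)
    zeroOrAtLeast i (suc zero) with i ∈ᵇ us in e
    ... | true = inj₂ (proj₁ (col2-range i e))
    ... | false = inj₁ (col2-unset i e)

  Invariant : ℕ → ℕ → List (Step n) → Set
  Invariant k h s = InvariantOn k h s (labelled s) (𝔇 s) (𝔘 s)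

  module UpStep {k h : ℕ} {s : List (Step n)} (1≤k : 1 ≤ k) (I : Invariant (suc k) (suc h) s) (m : Fin n)
    (m-available : available (𝔇 s) (𝔘 s) m ≡ true)
    (m-least : ∀ x → x Fin.< m → available (𝔇 s) (𝔘 s) x ≡ false) where
    open InvariantOn I

    σ σ′ : Tableau n
    σ = tableauFrom (suc k) (labelled s)
    σ′ = tableauFrom k (U (just m) ∷ labelled s)

    m∈𝔇 : m ∈ᵇ 𝔇 s ≡ true
    m∈𝔇 = proj₁ (∧-not-true _ _ m-available)

    m∉𝔘 : m ∈ᵇ 𝔘 s ≡ false
    m∉𝔘 = proj₂ (∧-not-true _ _ m-available)

    σ′-new : σ′ m col2 ≡ k
    σ′-new rewrite dec-true (m ≟F m) refl = refl

    agree : AgreeExcept m col2 σ σ′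
    agree i zero _ = refl
    agree i (suc zero) other with i ≟F m
    ... | yes refl = ⊥-elim (other (refl , refl))
    ... | no _ = refl

    ups⊆downs′ : ∀ x → x ∈ᵇ (m ∷ 𝔘 s) ≡ true → x ∈ᵇ 𝔇 s ≡ true
    ups⊆downs′ x with x ≟F m
    ... | yes refl = λ _ → m∈𝔇
    ... | no _ = ups⊆downs x

    height′ : count n (available (𝔇 s) (m ∷ 𝔘 s)) ≡ h
    height′ = ℕₚ.suc-injective (trans (sym m-closes) height≡)
      where
      m-closes : count n (available (𝔇 s) (𝔘 s)) ≡ suc (count n (available (𝔇 s) (m ∷ 𝔘 s)))
      m-closes = count-flip n _ _ m (∧-not-≡false _ (∈ᵇ-head m (𝔘 s))) m-available
        (λ x x≢m → cong (λ b → (x ∈ᵇ 𝔇 s) ∧ not b) (∈ᵇ-tail (𝔘 s) x≢m))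

    col2-range′ : ∀ i → i ∈ᵇ (m ∷ 𝔘 s) ≡ true → k ≤ σ′ i col2 × σ′ i col2 < σ′ i col1
    col2-range′ i with i ≟F m
    ... | yes refl = λ _ → ℕₚ.≤-refl , proj₁ (col1-range i m∈𝔇)
    ... | no _ = λ i∈𝔘 → ℕₚ.<⇒≤ (proj₁ (col2-range i i∈𝔘)) , proj₂ (col2-range i i∈𝔘)

    col2-unset′ : ∀ i → i ∈ᵇ (m ∷ 𝔘 s) ≡ false → σ′ i col2 ≡ 0
    col2-unset′ i with i ≟F m
    ... | yes refl = λ ()
    ... | no _ = col2-unset i

    triple′ : ∀ i r → i Fin.< r → i ∈ᵇ (m ∷ 𝔘 s) ≡ true → r ∈ᵇ (m ∷ 𝔘 s) ≡ true →
      σ′ r col2 ≤ σ′ i col1 → σ′ r col2 < σ′ i col2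
    triple′ i r i<r with i ≟F m | r ≟F m
    ... | yes refl | yes refl = ⊥-elim (Finₚ.<-irrefl refl i<r)
    ... | yes refl | no _ = λ _ r∈𝔘 r≤i →
      ⊥-elim (ℕₚ.<⇒≱ (available-before i r i<r m-available r∈𝔘) r≤i)
    ... | no _ | yes refl = λ i∈𝔘 _ _ → proj₁ (col2-range i i∈𝔘)
    ... | no _ | no _ = triple i r i<r

    available-before′ : ∀ i r → i Fin.< r → available (𝔇 s) (m ∷ 𝔘 s) i ≡ true → r ∈ᵇ (m ∷ 𝔘 s) ≡ true →
      σ′ i col1 < σ′ r col2
    available-before′ i r i<r with i ≟F m | r ≟F m
    ... | yes refl | _ = λ m-avail → ⊥-elim (∧-false m-avail)
    ... | no _ | yes refl = λ i-avail _ → ⊥-elim (true≢false (trans (sym i-avail) (m-least i i<r)))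
    ... | no _ | no _ = available-before i r i<r

    invariant : InvariantOn k h (up ∷ s) (U (just m) ∷ labelled s) (𝔇 s) (m ∷ 𝔘 s)
    invariant = record
      { ups-labelled = cong (just m ∷_) ups-labelled
      ; ups-unique = ∈ᵇ-false⇒All≢ (𝔘 s) m∉𝔘 ∷ ups-unique
      ; ups⊆downs = ups⊆downs′
      ; height≡ = height′
      ; col1-range = λ i i∈𝔇 → ℕₚ.<⇒≤ (proj₁ (col1-range i i∈𝔇)) , proj₂ (col1-range i i∈𝔇)
      ; col1-unset = col1-unset
      ; col2-range = col2-range′
      ; col2-unset = col2-unset′
      ; injective = injectiveOnNonzero-extend 1≤k σ′-new agree zeroOrAtLeast injective
      ; triple = triple′
      ; available-before = available-before′
      ; Φ-suffix = cong₂ _∷_ (stepAt-up n σ′ k m σ′-new)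
          (trans (map-interval-cong _ _ (suc k) (length s)
                   (stepAt-beyond 1≤k σ′-new agree (col2-unset m m∉𝔘))) Φ-suffix)
      }

  upStep : ∀ {k h s} → 1 ≤ k → Invariant (suc k) (suc h) s → Invariant k h (up ∷ s)
  upStep {k} {h} {s} 1≤k I with count≡suc⇒some n _ (InvariantOn.height≡ I)
  ... | x , x-available with first-allFin-just _ x x-available
  ...   | m , least , m-available , m-least =
    subst (λ md → InvariantOn k h (up ∷ s) (U md ∷ labelled s) (𝔇 s) (maybe (_∷ 𝔘 s) (𝔘 s) md))
      (sym least) (UpStep.invariant 1≤k I m m-available m-least)

  module DownStep {k h : ℕ} {j : Fin n} {s : List (Step n)} (1≤k : 1 ≤ k) (k≤2n : k ≤ 2 * n)
    (j∉𝔇 : j ∈ᵇ 𝔇 s ≡ false) (I : Invariant (suc k) h s) where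
    open InvariantOn I

    σ σ′ : Tableau n
    σ = tableauFrom (suc k) (labelled s)
    σ′ = tableauFrom k (D j ∷ labelled s)

    j∉𝔘 : j ∈ᵇ 𝔘 s ≡ false
    j∉𝔘 with j ∈ᵇ 𝔘 s in j∈𝔘
    ... | true = ⊥-elim (true≢false (trans (sym (ups⊆downs j j∈𝔘)) j∉𝔇))
    ... | false = refl

    σ′-new : σ′ j col1 ≡ k
    σ′-new rewrite dec-true (j ≟F j) refl = refl

    agree : AgreeExcept j col1 σ σ′
    agree i zero other with i ≟F j
    ... | yes refl = ⊥-elim (other (refl , refl))
    ... | no _ = refl
    agree i (suc zero) _ = refl

    j-available : available (j ∷ 𝔇 s) (𝔘 s) j ≡ true
    j-available rewrite ∈ᵇ-head j (𝔇 s) | j∉𝔘 = refl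

    ups⊆downs′ : ∀ x → x ∈ᵇ 𝔘 s ≡ true → x ∈ᵇ (j ∷ 𝔇 s) ≡ true
    ups⊆downs′ x with x ≟F j
    ... | yes refl = λ _ → refl
    ... | no _ = ups⊆downs x

    height′ : count n (available (j ∷ 𝔇 s) (𝔘 s)) ≡ suc h
    height′ = trans (count-flip n _ _ j (∧-≡false _ j∉𝔇) j-available
      (λ x x≢j → cong (λ a → a ∧ not (x ∈ᵇ 𝔘 s)) (sym (∈ᵇ-tail (𝔇 s) x≢j)))) (cong suc height≡)

    col1-range′ : ∀ i → i ∈ᵇ (j ∷ 𝔇 s) ≡ true → k ≤ σ′ i col1 × σ′ i col1 ≤ 2 * n
    col1-range′ i with i ≟F j
    ... | yes refl = λ _ → ℕₚ.≤-refl , k≤2n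
    ... | no _ = λ i∈𝔇 → ℕₚ.<⇒≤ (proj₁ (col1-range i i∈𝔇)) , proj₂ (col1-range i i∈𝔇)

    col1-unset′ : ∀ i → i ∈ᵇ (j ∷ 𝔇 s) ≡ false → σ′ i col1 ≡ 0
    col1-unset′ i with i ≟F j
    ... | yes refl = λ ()
    ... | no _ = col1-unset i

    col2-range′ : ∀ i → i ∈ᵇ 𝔘 s ≡ true → k ≤ σ′ i col2 × σ′ i col2 < σ′ i col1
    col2-range′ i with i ≟F j
    ... | yes refl = λ j∈𝔘 → ⊥-elim (true≢false (trans (sym j∈𝔘) j∉𝔘))
    ... | no _ = λ i∈𝔘 → ℕₚ.<⇒≤ (proj₁ (col2-range i i∈𝔘)) , proj₂ (col2-range i i∈𝔘)

    triple′ : ∀ i r → i Fin.< r → i ∈ᵇ 𝔘 s ≡ true → r ∈ᵇ 𝔘 s ≡ true →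
      σ′ r col2 ≤ σ′ i col1 → σ′ r col2 < σ′ i col2
    triple′ i r i<r with i ≟F j
    ... | yes refl = λ j∈𝔘 → ⊥-elim (true≢false (trans (sym j∈𝔘) j∉𝔘))
    ... | no _ = triple i r i<r

    available-before′ : ∀ i r → i Fin.< r → available (j ∷ 𝔇 s) (𝔘 s) i ≡ true → r ∈ᵇ 𝔘 s ≡ true →
      σ′ i col1 < σ′ r col2
    available-before′ i r i<r with i ≟F j
    ... | yes refl = λ _ r∈𝔘 → proj₁ (col2-range r r∈𝔘)
    ... | no _ = available-before i r i<r

    only-j-at-k : ∀ r c → σ′ r c ≡ k → r ≡ j × c ≡ col1
    only-j-at-k = only-new-cell-is-k 1≤k σ′-new agree zeroOrAtLeast

    no-up-at-k : ∀ r → σ′ r col2 ≢ k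
    no-up-at-k r σ′≡k with only-j-at-k r col2 σ′≡k
    ... | _ , ()

    invariant : Invariant k (suc h) (down j ∷ s)
    invariant = record
      { ups-labelled = ups-labelled
      ; ups-unique = ups-unique
      ; ups⊆downs = ups⊆downs′
      ; height≡ = height′
      ; col1-range = col1-range′
      ; col1-unset = col1-unset′
      ; col2-range = col2-range′
      ; col2-unset = col2-unset
      ; injective = injectiveOnNonzero-extend 1≤k σ′-new agree zeroOrAtLeast injective
      ; triple = triple′
      ; available-before = available-before′
      ; Φ-suffix = cong₂ _∷_
          (stepAt-down n σ′ k j σ′-new no-up-at-k (λ r σ′≡k → proj₁ (only-j-at-k r col1 σ′≡k)))
          (trans (map-interval-cong _ _ (suc k) (length s)
                   (stepAt-beyond 1≤k σ′-new agree (col1-unset j j∉𝔇))) Φ-suffix)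
      }

  invariant-end : ∀ {k h} → DyckFrom {n} h [] → Invariant k h []
  invariant-end {k} h≡0 = record
    { ups-labelled = refl
    ; ups-unique = []
    ; ups⊆downs = λ _ ()
    ; height≡ = trans (count-none n _ (λ _ → refl)) (sym h≡0)
    ; col1-range = λ _ ()
    ; col1-unset = λ _ _ → refl
    ; col2-range = λ _ ()
    ; col2-unset = λ _ _ → refl
    ; injective = λ i _ c _ _ ≢0 → ⊥-elim (≢0 (unset i c))
    ; triple = λ _ _ _ ()
    ; available-before = λ _ _ _ ()
    ; Φ-suffix = refl
    }
    where
    unset : ∀ i c → tableauFrom k [] i c ≡ 0
    unset i zero = refl
    unset i (suc _) = refl

  dyck-invariant : ∀ s k h → 1 ≤ k → k + length s ≡ suc (2 * n) → DyckFrom h s → Unique (downLabels s) →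
    Invariant k h s
  dyck-invariant [] k h _ _ dyck _ = invariant-end dyck
  dyck-invariant (up ∷ s) k h 1≤k k+l≡ dyck unique =
    upStep 1≤k (dyck-invariant s (suc k) (suc h) (s≤s z≤n) (trans (sym (ℕₚ.+-suc k (length s))) k+l≡)
                  dyck unique)
  dyck-invariant (down j ∷ s) k (suc h) 1≤k k+l≡ dyck (j∉s ∷ unique) =
    DownStep.invariant 1≤k k≤2n j∉𝔇 (dyck-invariant s (suc k) h (s≤s z≤n) k+l≡′ dyck unique)
    where
    k+l≡′ : suc k + length s ≡ suc (2 * n)
    k+l≡′ = trans (sym (ℕₚ.+-suc k (length s))) k+l≡

    k≤2n : k ≤ 2 * n
    k≤2n = subst (k ≤_) (ℕₚ.suc-injective k+l≡′) (ℕₚ.m≤m+n k (length s))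

    j∉𝔇 : j ∈ᵇ 𝔇 s ≡ false
    j∉𝔇 = trans (cong (j ∈ᵇ_) (𝔇≡downLabels s)) (All≢⇒∈ᵇ-false _ j∉s)

  Φ∘Θ : ∀ {h} path → length path ≡ 2 * n → Invariant 1 h path → Φ n (Θ n path) ≡ path
  Φ∘Θ path len I = begin
    map (stepAt n (Θ n path)) (map suc (upTo (2 * n)))
      ≡⟨ cong (map (stepAt n (Θ n path))) (map-suc-upTo (2 * n)) ⟩
    map (stepAt n (Θ n path)) (interval 1 (2 * n))
      ≡⟨ map-interval-cong _ _ 1 (2 * n) (λ m _ → stepAt-cong n _ _ m
           (λ r c → cong (λ v → does (v ℕ.≟ m)) (Θ≡tableauFrom path r c))) ⟩
    map (stepAt n σ) (interval 1 (2 * n))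
      ≡⟨ cong (λ l → map (stepAt n σ) (interval 1 l)) len ⟨
    map (stepAt n σ) (interval 1 (length path))
      ≡⟨ InvariantOn.Φ-suffix I ⟩
    path ∎
    where
    σ : Tableau n
    σ = tableauFrom 1 (labelled path)
    open ≡-Reasoning

  Θ-correct : ∀ path → IsLDyck n path →
      (upLabelList (labelUps path) ↭ map just (allFin n))
    × (downLabels path ↭ allFin n)
    × IsSPCT n (Θ n path)
    × (Φ n (Θ n path) ≡ path)
  Θ-correct path (len , dyck , unique) =
    subst (_↭ map just (allFin n)) (sym ups-labelled) (map⁺ just (↭-allFin ups-unique every-up)) ,
    ↭-allFin unique every-down ,
    (range , injective′ , (λ i → proj₂ (col2-range i (every-up i))) ,
             (λ i r i<r → triple i r i<r (every-up i) (every-up r))) ,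
    Φ∘Θ path len I
    where
    I : Invariant 1 0 path
    I = dyck-invariant path 1 0 (s≤s z≤n) (cong suc len) dyck unique
    open InvariantOn I

    n≡#downs : n ≡ length (downLabels path)
    n≡#downs = ℕₚ.*-cancelˡ-≡ n (length (downLabels path)) 2 (trans (sym len) (dyck-length 0 path dyck))

    every-down : ∀ x → x ∈ᵇ downLabels path ≡ true
    every-down = count≡n⇒all n _ (trans (sym (length-unique _ unique)) (sym n≡#downs))

    every-down-𝔇 : ∀ x → x ∈ᵇ 𝔇 path ≡ true
    every-down-𝔇 x = trans (cong (x ∈ᵇ_) (𝔇≡downLabels path)) (every-down x)

    every-up : ∀ x → x ∈ᵇ 𝔘 path ≡ true
    every-up x = ∧-not-false (trans (cong (λ a → a ∧ not (x ∈ᵇ 𝔘 path)) (sym (every-down-𝔇 x)))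
                                    (count≡0⇒none n _ height≡ x))

    range : ∀ i c → 1 ≤ Θ n path i c × Θ n path i c ≤ 2 * n
    range i zero = col1-range i (every-down-𝔇 i)
    range i (suc zero) = proj₁ (col2-range i (every-up i)) ,
      ℕₚ.<⇒≤ (ℕₚ.<-≤-trans (proj₂ (col2-range i (every-up i))) (proj₂ (col1-range i (every-down-𝔇 i))))

    injective′ : ∀ i j c d → Θ n path i c ≡ Θ n path j d → i ≡ j × c ≡ d
    injective′ i j c d e =
      injective i j c d (trans (sym (Θ≡tableauFrom path i c)) (trans e (Θ≡tableauFrom path j d)))
        (λ Θ≡0 → ℕₚ.<⇒≱ (proj₁ (range i c)) (ℕₚ.≤-reflexive (trans (Θ≡tableauFrom path i c) Θ≡0)))

lemma4p1 : (n : ℕ) → 1 ≤ n →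
    ((D : _) → IsLDyck n D →
        (upLabelList (labelUps D) ↭ map just (allFin n))
      × (downLabels D ↭ allFin n)
      × IsSPCT n (Θ n D)
      × (Φ n (Θ n D) ≡ D))
    × ((τ : Tableau n) → IsSPCT n τ →
        IsLDyck n (Φ n τ)
      × (∀ i c → Θ n (Φ n τ) i c ≡ τ i c))
lemma4p1 n _ = PathToTableau.Θ-correct , TableauToPath.Φ-correct
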